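{- Let $\varepsilon\in(0,1)$ with $1/\varepsilon$ a power of $2$, and let $M$ be an $n\times n$ image with $n-1$ a power of $2$. Let $i\in\{0,1,\dots,\log_2\frac1\varepsilon-2\}$ and let $s$ be a square of level $i$. Let $ch(s)$ denote the set of the $4$ squares of level $i+1$ contained in $s$. Then $$lc(s)\le elc(s)+\sum_{q\in ch(s)} lc(q).$$
   Context: Images are binary matrices (1 = black, 0 = white), indexed by $\{0,\dots,n-1\}^2$. The image graph of a (sub)image has its black pixels as vertices and edges between pixels at Manhattan distance 1. A (sub)image $s$ is border-connected if every black pixel of $s$ is joined, by a path in the image graph of $s$, to a pixel on the border of $s$ (its first/last row or column); $\mathcal C'$ is the set of border-connected images, and $\mathrm{Dist}(s,\mathcal C')$ is the minimum number of pixels of $s$ to change to obtain a border-connected image of the same size. For $i\in\{0,\dots,\log_2\frac1\varepsilon-1\}$ let $k_i=\frac4\varepsilon 2^{ -i}-1$. For integers $u,v$ divisible by $k_i+1$ (with the square lying inside the image), the $k_i\times k_i$ subimage consisting of pixels $\{u+1,\dots,u+k_i\}\times\{v+1,\dots,v+k_i\}$ is a square of level $i$. For a square $s$ of level $i$, its local cost is $lc(s)=\mathrm{Dist}(s,\mathcal C')$ and its effective local cost is $elc(s)=\min(2k_i,lc(s))$. -}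

module Defs where

open import Data.Nat using (ℕ; zero; suc; _+_; _*_; _∸_; _^_; _≤_; _<_; _⊓_)
open import Data.Nat.Divisibility using (_∣_)
open import Data.Bool using (Bool; true; false; _xor_; if_then_else_)
open import Data.Product using (Σ; _×_; _,_)
open import Data.Sum using (_⊎_)
open import Relation.Binary.PropositionalEquality using (_≡_)

-- An image is a function from pixel coordinates (row, column) to colours
-- (true = black = 1, false = white = 0).  A "k-image" is such a function
-- of which only the pixels {0..k-1}² are relevant.
Image : Set
Image = ℕ → ℕ → Bool

sumTo : ℕ → (ℕ → ℕ) → ℕ
sumTo zero    f = 0
sumTo (suc k) f = sumTo k f + f k

hamming : ℕ → Image → Image → ℕ
hamming k s t = sumTo k (λ a → sumTo k (λ b → if s a b xor t a b then 1 else 0))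

data Adj : ℕ → ℕ → ℕ → ℕ → Set where
  down  : ∀ a b → Adj a b (suc a) b
  up    : ∀ a b → Adj (suc a) b a b
  right : ∀ a b → Adj a b a (suc b)
  left  : ∀ a b → Adj a (suc b) a b

OnBorder : ℕ → ℕ → ℕ → Set
OnBorder k a b = (a ≡ 0) ⊎ (suc a ≡ k) ⊎ (b ≡ 0) ⊎ (suc b ≡ k)

data Reach (k : ℕ) (t : Image) : ℕ → ℕ → Set where
  here : ∀ {a b} → a < k → b < k → t a b ≡ true → OnBorder k a b → Reach k t a b
  step : ∀ {a b a' b'} → a < k → b < k → t a b ≡ true →
         Adj a b a' b' → Reach k t a' b' → Reach k t a b

BorderConnected : ℕ → Image → Set
BorderConnected k t = ∀ a b → a < k → b < k → t a b ≡ true → Reach k t a b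

IsDist : ℕ → Image → ℕ → Set
IsDist k s d =
  Σ Image (λ t → BorderConnected k t × hamming k s t ≡ d)
  × (∀ t → BorderConnected k t → d ≤ hamming k s t)

-- The k×k subimage of M with pixels {u+1..u+k}×{v+1..v+k}, re-indexed from 0.
sub : Image → ℕ → ℕ → Image
sub M u v a b = M (u + suc a) (v + suc b)

-- With 1/ε = 2^m : k_i = (4/ε)·2^{-i} - 1 = 2^{(m-i)+2} - 1  (for i ≤ m).
side : ℕ → ℕ → ℕ
side m i = 2 ^ ((m ∸ i) + 2) ∸ 1

IsSquare : ℕ → ℕ → ℕ → ℕ → ℕ → Set
IsSquare m n i u v =
  (suc (side m i) ∣ u) × (suc (side m i) ∣ v)
  × (u + side m i < n) × (v + side m i < n)

{-# OPTIONS --safe #-}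
module Submission where

-- Write the side of s as 2K+1, so that its children are the four K-blocks left over when
-- row K and column K are removed.  Glue optimal border-connected repairs of the children
-- and paint that cross black.  A path inside a child ends on the child's border, which lies
-- on the border of s or next to the cross, and the cross reaches the border of s; so the
-- glued image is border-connected.  It differs from s by at most Σ lc(q) inside the
-- children plus the 4K+1 < 2(2K+1) cross pixels, giving lc(s) ≤ 2kᵢ + Σ lc(q); if instead
-- lc(s) ≤ 2kᵢ then elc(s) = lc(s) and the bound is trivial.

open import Defs
open import Data.Nat using (ℕ; zero; suc; _+_; _*_; _∸_; _^_; _≤_; _<_; _⊓_; z≤n; s≤s)
open import Data.Nat.Properties
open import Data.Nat.Tactic.RingSolver using (solve-∀)
open import Algebra.Properties.CommutativeSemigroup +-commutativeSemigroup using (interchange)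
open import Data.Bool using (Bool; true; false; _xor_; if_then_else_)
open import Data.Product using (Σ; _×_; _,_; proj₁; proj₂)
open import Data.Sum using (_⊎_; inj₁; inj₂)
open import Relation.Binary using (tri<; tri≈; tri>)
open import Relation.Binary.PropositionalEquality using (_≡_; refl; sym; trans; cong; cong₂; subst)

sumTo-cong : ∀ k {f g : ℕ → ℕ} → (∀ j → j < k → f j ≡ g j) → sumTo k f ≡ sumTo k g
sumTo-cong zero    f≡g = refl
sumTo-cong (suc k) f≡g = cong₂ _+_ (sumTo-cong k (λ j j<k → f≡g j (m<n⇒m<1+n j<k))) (f≡g k ≤-refl)

sumTo-mono-≤ : ∀ k {f g : ℕ → ℕ} → (∀ j → j < k → f j ≤ g j) → sumTo k f ≤ sumTo k g
sumTo-mono-≤ zero    f≤g = ≤-refl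
sumTo-mono-≤ (suc k) f≤g = +-mono-≤ (sumTo-mono-≤ k (λ j j<k → f≤g j (m<n⇒m<1+n j<k))) (f≤g k ≤-refl)

sumTo-≤-length : ∀ k (f : ℕ → ℕ) → (∀ j → f j ≤ 1) → sumTo k f ≤ k
sumTo-≤-length zero    f f≤1 = z≤n
sumTo-≤-length (suc k) f f≤1 =
  subst (sumTo k f + f k ≤_) (+-comm k 1) (+-mono-≤ (sumTo-≤-length k f f≤1) (f≤1 k))

sumTo-+ : ∀ a b f → sumTo (a + b) f ≡ sumTo a f + sumTo b (λ j → f (a + j))
sumTo-+ a zero    f rewrite +-identityʳ a = sym (+-identityʳ _)
sumTo-+ a (suc b) f rewrite +-suc a b =
  trans (cong (_+ f (a + b)) (sumTo-+ a b f)) (+-assoc (sumTo a f) _ _)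

sumTo-distrib-+ : ∀ k (f g : ℕ → ℕ) → sumTo k (λ j → f j + g j) ≡ sumTo k f + sumTo k g
sumTo-distrib-+ zero    f g = refl
sumTo-distrib-+ (suc k) f g rewrite sumTo-distrib-+ k f g =
  interchange (sumTo k f) (sumTo k g) (f k) (g k)

sum² : ℕ → (ℕ → ℕ → ℕ) → ℕ
sum² k f = sumTo k (λ a → sumTo k (f a))

sum²-cong : ∀ k {f g : ℕ → ℕ → ℕ} → (∀ a b → a < k → b < k → f a b ≡ g a b) → sum² k f ≡ sum² k g
sum²-cong k f≡g = sumTo-cong k (λ a a<k → sumTo-cong k (λ b b<k → f≡g a b a<k b<k))

offset : Bool → ℕ → ℕ
offset false K = 0
offset true  K = suc K

sumQuadrants : (Bool → Bool → ℕ) → ℕ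
sumQuadrants f = f false false + f false true + f true false + f true true

differ : Bool → Bool → ℕ
differ p q = if p xor q then 1 else 0

differ≤1 : ∀ p q → differ p q ≤ 1
differ≤1 false false = z≤n
differ≤1 false true  = ≤-refl
differ≤1 true  false = ≤-refl
differ≤1 true  true  = z≤n

sumQuadrants-cong : ∀ {f g : Bool → Bool → ℕ} → (∀ o₁ o₂ → f o₁ o₂ ≡ g o₁ o₂) → sumQuadrants f ≡ sumQuadrants g
sumQuadrants-cong f≡g =
  cong₂ _+_ (cong₂ _+_ (cong₂ _+_ (f≡g false false) (f≡g false true)) (f≡g true false)) (f≡g true true)

block : ℕ → (ℕ → ℕ → ℕ) → Bool → Bool → ℕ
block K f o₁ o₂ = sum² K (λ a b → f (offset o₁ K + a) (offset o₂ K + b))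

sumTo-around : ∀ K (g : ℕ → ℕ) → sumTo (suc K + K) g ≡ sumTo K g + g K + sumTo K (λ j → g (suc K + j))
sumTo-around K = sumTo-+ (suc K) K

sum²-cross-≤ : ∀ K (f : ℕ → ℕ → ℕ) → (∀ x y → f x y ≤ 1) →
               sum² (suc K + K) f ≤ sumQuadrants (block K f) + (suc K + K + 2 * K)
sum²-cross-≤ K f f≤1 = begin
  sum² N f                                                  ≡⟨ sumTo-around K row ⟩
  sumTo K (λ a → row a) + row K + sumTo K (λ a → row (suc K + a))
    ≤⟨ +-mono-≤ (+-mono-≤ (rows false) (sumTo-≤-length N (f K) (f≤1 K))) (rows true) ⟩
  (B false false + K + B false true) + N + (B true false + K + B true true)
    ≡⟨ rearrange (B false false) (B false true) (B true false) (B true true) K ⟩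
  sumQuadrants B + (N + 2 * K)                              ∎
  where
  open ≤-Reasoning
  N = suc K + K
  B = block K f
  row : ℕ → ℕ
  row x = sumTo N (f x)

  row-≤ : ∀ x → row x ≤ sumTo K (f x) + 1 + sumTo K (λ b → f x (suc K + b))
  row-≤ x rewrite sumTo-around K (f x) =
    +-monoˡ-≤ (sumTo K (λ b → f x (suc K + b))) (+-monoʳ-≤ (sumTo K (f x)) (f≤1 x K))

  rows : ∀ o → sumTo K (λ a → row (offset o K + a)) ≤ B o false + K + B o true
  rows o = begin
    sumTo K (λ a → row (x a))                               ≤⟨ sumTo-mono-≤ K (λ a _ → row-≤ (x a)) ⟩
    sumTo K (λ a → sumTo K (f (x a)) + 1 + sumTo K (λ b → f (x a) (suc K + b)))
      ≡⟨ trans (sumTo-distrib-+ K _ _) (cong (_+ B o true) (sumTo-distrib-+ K _ _)) ⟩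
    B o false + sumTo K (λ _ → 1) + B o true
      ≤⟨ +-monoˡ-≤ (B o true) (+-monoʳ-≤ (B o false) (sumTo-≤-length K _ (λ _ → ≤-refl))) ⟩
    B o false + K + B o true                                ∎
    where
    x : ℕ → ℕ
    x a = offset o K + a

  rearrange : ∀ A B C E K → (A + K + B) + (suc K + K) + (C + K + E) ≡ (A + B + C + E) + (suc K + K + 2 * K)
  rearrange = solve-∀

glue : {X : Set} → ℕ → (ℕ → X) → X → (ℕ → X) → ℕ → X
glue zero    lo mid hi zero    = mid
glue zero    lo mid hi (suc b) = hi b
glue (suc K) lo mid hi zero    = lo 0
glue (suc K) lo mid hi (suc a) = glue K (λ j → lo (suc j)) mid hi a

glue-centre : ∀ {X : Set} K (lo : ℕ → X) mid hi → glue K lo mid hi K ≡ mid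
glue-centre zero    lo mid hi = refl
glue-centre (suc K) lo mid hi = glue-centre K (λ j → lo (suc j)) mid hi

glue-block : ∀ {X : Set} K (f : Bool → ℕ → X) mid o a → a < K →
             glue K (f false) mid (f true) (offset o K + a) ≡ f o a
glue-block K f mid true a _ = above K (f false)
  where
  above : ∀ K lo → glue K lo mid (f true) (suc K + a) ≡ f true a
  above zero    lo = refl
  above (suc K) lo = above K (λ j → lo (suc j))
glue-block K f mid false a a<K = below K a (f false) a<K
  where
  below : ∀ K a lo → a < K → glue K lo mid (f true) a ≡ lo a
  below (suc K) zero    lo _         = refl
  below (suc K) (suc a) lo (s≤s a<K) = below K a (λ j → lo (suc j)) a<K

glue-const : ∀ {X : Set} K (lo : ℕ → X) mid hi c → (∀ a → lo a ≡ c) → mid ≡ c → (∀ a → hi a ≡ c) →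
             ∀ x → glue K lo mid hi x ≡ c
glue-const zero    lo mid hi c lo≡c mid≡c hi≡c zero    = mid≡c
glue-const zero    lo mid hi c lo≡c mid≡c hi≡c (suc x) = hi≡c x
glue-const (suc K) lo mid hi c lo≡c mid≡c hi≡c zero    = lo≡c 0
glue-const (suc K) lo mid hi c lo≡c mid≡c hi≡c (suc x) =
  glue-const K (λ j → lo (suc j)) mid hi c (λ a → lo≡c (suc a)) mid≡c hi≡c x

data Position (K : ℕ) : ℕ → Set where
  centre  : Position K K
  inBlock : ∀ o {a} → a < K → Position K (offset o K + a)

position : ∀ K x → x < suc K + K → Position K x
position K x x<N with <-cmp x K
... | tri< x<K _ _ = inBlock false x<K
... | tri≈ _ refl _ = centre
... | tri> _ _ K<x = subst (Position K) (m+[n∸m]≡n K<x) (inBlock true x∸K<K)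
  where
  x∸K<K : x ∸ suc K < K
  x∸K<K = subst (x ∸ suc K <_) (m+n∸m≡n (suc K) K) (∸-monoˡ-< x<N K<x)

Adj-shift : ∀ o₁ o₂ {a b a' b'} → Adj a b a' b' → Adj (o₁ + a) (o₂ + b) (o₁ + a') (o₂ + b')
Adj-shift o₁ o₂ (down a b)  = subst (λ z → Adj (o₁ + a) (o₂ + b) z (o₂ + b)) (sym (+-suc o₁ a)) (down _ _)
Adj-shift o₁ o₂ (up a b)    = subst (λ z → Adj z (o₂ + b) (o₁ + a) (o₂ + b)) (sym (+-suc o₁ a)) (up _ _)
Adj-shift o₁ o₂ (right a b) = subst (λ z → Adj (o₁ + a) (o₂ + b) (o₁ + a) z) (sym (+-suc o₂ b)) (right _ _)
Adj-shift o₁ o₂ (left a b)  = subst (λ z → Adj (o₁ + a) z (o₁ + a) (o₂ + b)) (sym (+-suc o₂ b)) (left _ _)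

module CrossGluing (K : ℕ) (t : Bool → Bool → Image) where

  N : ℕ
  N = suc K + K

  rowOf : ℕ → Bool → ℕ → Bool
  rowOf y o a = glue K (t o false a) true (t o true a) y

  glued : Image
  glued x y = glue K (rowOf y false) true (rowOf y true) x

  glued-block : ∀ o₁ o₂ {a b} → a < K → b < K → glued (offset o₁ K + a) (offset o₂ K + b) ≡ t o₁ o₂ a b
  glued-block o₁ o₂ {a} {b} a<K b<K =
    trans (glue-block K (rowOf _) true o₁ a a<K) (glue-block K (λ o → t o₁ o a) true o₂ b b<K)

  glued-row : ∀ y → glued K y ≡ true
  glued-row y = glue-centre K _ true _

  glued-col : ∀ x → glued x K ≡ true
  glued-col = glue-const K _ true _ true (λ a → glue-centre K _ true _) refl (λ a → glue-centre K _ true _)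

  K<N : K < N
  K<N = s≤s (m≤m+n K K)

  offset-< : ∀ o {a} → a < K → offset o K + a < N
  offset-< false a<K = <-trans a<K K<N
  offset-< true  a<K = +-monoʳ-< (suc K) a<K

  reach-row : ∀ y → y < N → Reach N glued K y
  reach-row zero    y<N = here K<N y<N (glued-row 0) (inj₂ (inj₂ (inj₁ refl)))
  reach-row (suc y) y<N = step K<N y<N (glued-row (suc y)) (left K y) (reach-row y (<-trans (n<1+n y) y<N))

  reach-col : ∀ x → x < N → Reach N glued x K
  reach-col zero    x<N = here x<N K<N (glued-col 0) (inj₁ refl)
  reach-col (suc x) x<N = step x<N K<N (glued-col (suc x)) (up x K) (reach-col x (<-trans (n<1+n x) x<N))

  NextToCross : ℕ → ℕ → Set
  NextToCross x y = Adj x y K y ⊎ Adj x y x K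

  reach-nearCross : ∀ {x y} → x < N → y < N → glued x y ≡ true → OnBorder N x y ⊎ NextToCross x y →
                    Reach N glued x y
  reach-nearCross     x<N y<N black (inj₁ onBorder)   = here x<N y<N black onBorder
  reach-nearCross {x} {y} x<N y<N black (inj₂ (inj₁ adj)) = step x<N y<N black adj (reach-row y y<N)
  reach-nearCross {x} {y} x<N y<N black (inj₂ (inj₂ adj)) = step x<N y<N black adj (reach-col x x<N)

  upper-first : ∀ {c} → c ≡ 0 → suc K + c ≡ suc K
  upper-first c≡0 = trans (cong (suc K +_) c≡0) (+-identityʳ (suc K))

  upper-last : ∀ {c} → suc c ≡ K → suc (suc K + c) ≡ N
  upper-last sc≡K = trans (sym (+-suc (suc K) _)) (cong (suc K +_) sc≡K)

  blockBorder : ∀ o₁ o₂ {a b} → OnBorder K a b →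
                OnBorder N (offset o₁ K + a) (offset o₂ K + b) ⊎ NextToCross (offset o₁ K + a) (offset o₂ K + b)
  blockBorder false o₂       (inj₁ a≡0) = inj₁ (inj₁ a≡0)
  blockBorder true  o₂ {a} {b} (inj₁ a≡0) =
    inj₂ (inj₁ (subst (λ z → Adj z (offset o₂ K + b) K (offset o₂ K + b)) (sym (upper-first a≡0)) (up K _)))
  blockBorder false o₂ {a} {b} (inj₂ (inj₁ sa≡K)) =
    inj₂ (inj₁ (subst (λ z → Adj a (offset o₂ K + b) z (offset o₂ K + b)) sa≡K (down a _)))
  blockBorder true  o₂       (inj₂ (inj₁ sa≡K)) = inj₁ (inj₂ (inj₁ (upper-last sa≡K)))
  blockBorder o₁ false       (inj₂ (inj₂ (inj₁ b≡0))) = inj₁ (inj₂ (inj₂ (inj₁ b≡0)))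
  blockBorder o₁ true  {a} {b} (inj₂ (inj₂ (inj₁ b≡0))) =
    inj₂ (inj₂ (subst (λ z → Adj (offset o₁ K + a) z (offset o₁ K + a) K) (sym (upper-first b≡0)) (left _ K)))
  blockBorder o₁ false {a} {b} (inj₂ (inj₂ (inj₂ sb≡K))) =
    inj₂ (inj₂ (subst (λ z → Adj (offset o₁ K + a) b (offset o₁ K + a) z) sb≡K (right _ b)))
  blockBorder o₁ true        (inj₂ (inj₂ (inj₂ sb≡K))) = inj₁ (inj₂ (inj₂ (inj₂ (upper-last sb≡K))))

  reach-lift : ∀ o₁ o₂ {a b} → Reach K (t o₁ o₂) a b → Reach N glued (offset o₁ K + a) (offset o₂ K + b)
  reach-lift o₁ o₂ (here a<K b<K black onBorder) =
    reach-nearCross (offset-< o₁ a<K) (offset-< o₂ b<K) (trans (glued-block o₁ o₂ a<K b<K) black)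
                    (blockBorder o₁ o₂ onBorder)
  reach-lift o₁ o₂ (step a<K b<K black adj r) =
    step (offset-< o₁ a<K) (offset-< o₂ b<K) (trans (glued-block o₁ o₂ a<K b<K) black)
         (Adj-shift (offset o₁ K) (offset o₂ K) adj) (reach-lift o₁ o₂ r)

  glued-borderConnected : (∀ o₁ o₂ → BorderConnected K (t o₁ o₂)) → BorderConnected N glued
  glued-borderConnected bc x y x<N y<N black with position K x x<N | position K y y<N
  ... | centre         | _              = reach-row y y<N
  ... | inBlock o₁ _   | centre         = reach-col x x<N
  ... | inBlock o₁ a<K | inBlock o₂ b<K =
    reach-lift o₁ o₂ (bc o₁ o₂ _ _ a<K b<K (trans (sym (glued-block o₁ o₂ a<K b<K)) black))

  hamming-glued : ∀ (S : Image) (s : Bool → Bool → Image) →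
                  (∀ o₁ o₂ a b → S (offset o₁ K + a) (offset o₂ K + b) ≡ s o₁ o₂ a b) →
                  hamming N S glued ≤ sumQuadrants (λ o₁ o₂ → hamming K (s o₁ o₂) (t o₁ o₂)) + (N + 2 * K)
  hamming-glued S s S-block =
    subst (λ z → hamming N S glued ≤ z + (N + 2 * K)) (sumQuadrants-cong block≡hamming)
          (sum²-cross-≤ K f (λ x y → differ≤1 (S x y) (glued x y)))
    where
    f : ℕ → ℕ → ℕ
    f x y = differ (S x y) (glued x y)

    block≡hamming : ∀ o₁ o₂ → block K f o₁ o₂ ≡ hamming K (s o₁ o₂) (t o₁ o₂)
    block≡hamming o₁ o₂ =
      sum²-cong K (λ a b a<K b<K → cong₂ differ (S-block o₁ o₂ a b) (glued-block o₁ o₂ a<K b<K))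

corner : ℕ → ℕ → Bool → ℕ
corner K u false = u
corner K u true  = u + suc K

sub-block : ∀ M u v K o₁ o₂ a b →
            sub M u v (offset o₁ K + a) (offset o₂ K + b) ≡ sub M (corner K u o₁) (corner K v o₂) a b
sub-block M u v K o₁ o₂ a b = cong₂ M (shift u o₁ a) (shift v o₂ b)
  where
  shift : ∀ u o a → u + suc (offset o K + a) ≡ corner K u o + suc a
  shift u false a = refl
  shift u true  a = sym (trans (+-assoc u (suc K) (suc a)) (cong (u +_) (+-suc (suc K) a)))

dist-≤-quadrants : ∀ K M u v d (dq : Bool → Bool → ℕ) →
                   IsDist (suc K + K) (sub M u v) d →
                   (∀ o₁ o₂ → IsDist K (sub M (corner K u o₁) (corner K v o₂)) (dq o₁ o₂)) →
                   d ≤ 2 * (suc K + K) + sumQuadrants dq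
dist-≤-quadrants K M u v d dq (_ , d-minimal) child = begin
  d                                                 ≤⟨ d-minimal glued (glued-borderConnected connected) ⟩
  hamming N (sub M u v) glued                       ≤⟨ hamming-glued (sub M u v) s (sub-block M u v K) ⟩
  sumQuadrants (λ o₁ o₂ → hamming K (s o₁ o₂) (t o₁ o₂)) + (N + 2 * K)
    ≡⟨ cong (_+ (N + 2 * K)) (sumQuadrants-cong (λ o₁ o₂ → proj₂ (proj₂ (optimal o₁ o₂)))) ⟩
  sumQuadrants dq + (N + 2 * K)                     ≤⟨ +-monoʳ-≤ (sumQuadrants dq) cross≤2N ⟩
  sumQuadrants dq + 2 * N                           ≡⟨ +-comm (sumQuadrants dq) (2 * N) ⟩
  2 * N + sumQuadrants dq                           ∎
  where
  open ≤-Reasoning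
  s : Bool → Bool → Image
  s o₁ o₂ = sub M (corner K u o₁) (corner K v o₂)
  optimal : ∀ o₁ o₂ → Σ Image (λ t → BorderConnected K t × hamming K (s o₁ o₂) t ≡ dq o₁ o₂)
  optimal o₁ o₂ = proj₁ (child o₁ o₂)
  t : Bool → Bool → Image
  t o₁ o₂ = proj₁ (optimal o₁ o₂)
  connected : ∀ o₁ o₂ → BorderConnected K (t o₁ o₂)
  connected o₁ o₂ = proj₁ (proj₂ (optimal o₁ o₂))
  open CrossGluing K t
  cross≤2N : N + 2 * K ≤ 2 * N
  cross≤2N = subst (N + 2 * K ≤_) (sym (2N≡1+cross K)) (n≤1+n _)
    where
    2N≡1+cross : ∀ K → 2 * (suc K + K) ≡ suc (suc K + K + 2 * K)
    2N≡1+cross = solve-∀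

side-suc : ∀ m i → i + 2 ≤ m → side m i ≡ suc (side m (suc i)) + side m (suc i)
side-suc m i i+2≤m rewrite +-∸-assoc 1 (≤-trans (m<m+n i (s≤s z≤n)) i+2≤m) =
  double∸1 (2 ^ ((m ∸ suc i) + 2)) (m^n>0 2 ((m ∸ suc i) + 2))
  where
  double∸1 : ∀ P → 0 < P → 2 * P ∸ 1 ≡ suc (P ∸ 1) + (P ∸ 1)
  double∸1 (suc Q) _ = Q+[1+Q+0]≡1+Q+Q Q
    where
    Q+[1+Q+0]≡1+Q+Q : ∀ Q → Q + (suc Q + 0) ≡ suc Q + Q
    Q+[1+Q+0]≡1+Q+Q = solve-∀

m≤n+o⇒m≤n⊓m+o : ∀ {m n o} → m ≤ n + o → m ≤ n ⊓ m + o
m≤n+o⇒m≤n⊓m+o {m} {n} {o} m≤n+o with ≤-total n m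
... | inj₁ n≤m rewrite m≤n⇒m⊓n≡m n≤m = m≤n+o
... | inj₂ m≤n rewrite m≥n⇒m⊓n≡n m≤n = m≤m+n m o

claim3p3 : (m n p i u v : ℕ) → (M : Image) →
    n ≡ 2 ^ p + 1 → i + 2 ≤ m → IsSquare m n i u v →
    (d d₀₀ d₀₁ d₁₀ d₁₁ : ℕ) →
    IsDist (side m i) (sub M u v) d →
    IsDist (side m (suc i)) (sub M u v) d₀₀ →
    IsDist (side m (suc i)) (sub M u (v + suc (side m (suc i)))) d₀₁ →
    IsDist (side m (suc i)) (sub M (u + suc (side m (suc i))) v) d₁₀ →
    IsDist (side m (suc i)) (sub M (u + suc (side m (suc i))) (v + suc (side m (suc i)))) d₁₁ →
    d ≤ ((2 * side m i) ⊓ d) + (d₀₀ + d₀₁ + d₁₀ + d₁₁)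
claim3p3 m n p i u v M _ i+2≤m _ d d₀₀ d₀₁ d₁₀ d₁₁ lc lc₀₀ lc₀₁ lc₁₀ lc₁₁
  with side m i | side-suc m i i+2≤m
... | .(suc (side m (suc i)) + side m (suc i)) | refl =
  m≤n+o⇒m≤n⊓m+o {n = 2 * (suc K + K)} (dist-≤-quadrants K M u v d lc-child lc
    λ { false false → lc₀₀ ; false true → lc₀₁ ; true false → lc₁₀ ; true true → lc₁₁ })
  where
  K = side m (suc i)
  lc-child : Bool → Bool → ℕ
  lc-child false false = d₀₀
  lc-child false true  = d₀₁
  lc-child true  false = d₁₀
  lc-child true  true  = d₁₁
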